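{- Let $H$ be a non-trivial Heyting algebra (i.e. $\bot\neq\top$) and let $x\#y$ be a non-trivial apartness term in $H$. Then $\top\#y=\neg y$ for all $y\in H$.
   Context: A Heyting algebra is a bounded distributive lattice $\langle H,\wedge,\vee,\rightarrow,\bot,\top\rangle$ in which $a\rightarrow b$ is the largest $c$ with $a\wedge c\le b$; write $\neg a$ for $a\rightarrow\bot$. A term $x\# y$ (a term in the first-order language of Heyting algebras with free variables $x,y$) is an apartness term in $H$ if for all $x,y,z\in H$: $x\#x=\bot$; $x\#y=y\#x$; $x\#y\le (x\#z)\vee(z\#y)$. It is trivial if $x\#y=\bot$ for all $x,y\in H$, and non-trivial otherwise. -}

module Defs where

open import Level using (Level)
open import Data.Product using (∃₂)
open import Relation.Nullary using (¬_)
open import Relation.Binary.Lattice.Bundles using (HeytingAlgebra)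

data Term₂ : Set where
  varX varY : Term₂
  ⊤ₜ ⊥ₜ     : Term₂
  _∧ₜ_ _∨ₜ_ _⇒ₜ_ : Term₂ → Term₂ → Term₂

module _ {c ℓ₁ ℓ₂ : Level} (H : HeytingAlgebra c ℓ₁ ℓ₂) where
  open HeytingAlgebra H

  neg : Carrier → Carrier
  neg a = a ⇨ ⊥

  ⟦_⟧ : Term₂ → Carrier → Carrier → Carrier
  ⟦ varX ⟧ a b = a
  ⟦ varY ⟧ a b = b
  ⟦ ⊤ₜ ⟧ a b = ⊤
  ⟦ ⊥ₜ ⟧ a b = ⊥
  ⟦ s ∧ₜ t ⟧ a b = ⟦ s ⟧ a b ∧ ⟦ t ⟧ a b
  ⟦ s ∨ₜ t ⟧ a b = ⟦ s ⟧ a b ∨ ⟦ t ⟧ a b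
  ⟦ s ⇒ₜ t ⟧ a b = ⟦ s ⟧ a b ⇨ ⟦ t ⟧ a b

  NonTrivialHA : Set ℓ₁
  NonTrivialHA = ¬ (⊥ ≈ ⊤)

  record IsApartnessTerm (t : Term₂) : Set (c Level.⊔ ℓ₁ Level.⊔ ℓ₂) where
    field
      irrefl : ∀ x → ⟦ t ⟧ x x ≈ ⊥
      sym    : ∀ x y → ⟦ t ⟧ x y ≈ ⟦ t ⟧ y x
      cotrans : ∀ x y z → ⟦ t ⟧ x y ≤ (⟦ t ⟧ x z ∨ ⟦ t ⟧ z y)

  TrivialTerm : Term₂ → Set (c Level.⊔ ℓ₁)
  TrivialTerm t = ∀ x y → ⟦ t ⟧ x y ≈ ⊥

  NonTrivialTerm : Term₂ → Set (c Level.⊔ ℓ₁)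
  NonTrivialTerm t = ¬ TrivialTerm t

-- Relative to an element e, write a ≃[ e ] b when e ∧ a ≤ b and e ∧ b ≤ a.
-- Every term is a congruence for this relation, and y ≃[ y ] ⊤ and y ≃[ ¬ y ] ⊥.
-- Hence y ∧ (⊤ # y) ≤ ⊤ # ⊤ = ⊥, i.e. ⊤ # y ≤ ¬ y, and ¬ y ∧ (⊤ # y) = ¬ y ∧ (⊤ # ⊥).
-- A term evaluated at ⊤ and ⊥ is ⊤ or ⊥. If ⊤ # ⊥ = ⊤ then ¬ y ≤ ⊤ # y and we are
-- done; if ⊤ # ⊥ = ⊥ then ⊤ # z = ¬ z ∧ (⊤ # z) ≤ ⊥ for all z, and cotransitivity
-- through ⊤ makes the apartness trivial.
module Submission where

open import Defs
open import Level using (Level)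
open import Data.Product using (_×_; _,_; proj₁; proj₂)
open import Data.Sum using (_⊎_; inj₁; inj₂)
open import Relation.Nullary using (contradiction)
open import Relation.Binary.Lattice.Bundles using (HeytingAlgebra)
import Relation.Binary.Lattice.Properties.HeytingAlgebra as HeytingAlgebraProperties
import Relation.Binary.Lattice.Properties.MeetSemilattice as MeetSemilatticeProperties
import Relation.Binary.Lattice.Properties.JoinSemilattice as JoinSemilatticeProperties
import Relation.Binary.Reasoning.PartialOrder as PosetReasoning

module _ {c ℓ₁ ℓ₂ : Level} (H : HeytingAlgebra c ℓ₁ ℓ₂) where
  open HeytingAlgebra H
  open HeytingAlgebraProperties H using (⇨-eval; swap-transpose-⇨; ∧-distribˡ-∨-≤)
  open MeetSemilatticeProperties meetSemilattice using (∧-monotonic)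
  open JoinSemilatticeProperties joinSemilattice using (∨-monotonic)
  open PosetReasoning poset

  infix 4 _≤[_]_ _≃[_]_

  _≤[_]_ : Carrier → Carrier → Carrier → Set ℓ₂
  a ≤[ e ] b = e ∧ a ≤ b

  _≃[_]_ : Carrier → Carrier → Carrier → Set ℓ₂
  a ≃[ e ] b = a ≤[ e ] b × b ≤[ e ] a

  ≃[]-refl : ∀ {e a} → a ≃[ e ] a
  ≃[]-refl {e} {a} = x∧y≤y e a , x∧y≤y e a

  ≃[self]⊤ : ∀ a → a ≃[ a ] ⊤
  ≃[self]⊤ a = maximum (a ∧ a) , x∧y≤x a ⊤

  ≃[neg]⊥ : ∀ a → a ≃[ neg H a ] ⊥
  ≃[neg]⊥ a = ⇨-eval , trans (x∧y≤y (neg H a) ⊥) (minimum a)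

  ∧-mono-≤[] : ∀ {e a a′ b b′} → a ≤[ e ] a′ → b ≤[ e ] b′ → a ∧ b ≤[ e ] a′ ∧ b′
  ∧-mono-≤[] {e} {a} {b = b} a≤a′ b≤b′ = ∧-greatest
    (trans (∧-monotonic refl (x∧y≤x a b)) a≤a′)
    (trans (∧-monotonic refl (x∧y≤y a b)) b≤b′)

  ∨-mono-≤[] : ∀ {e a a′ b b′} → a ≤[ e ] a′ → b ≤[ e ] b′ → a ∨ b ≤[ e ] a′ ∨ b′
  ∨-mono-≤[] {e} {a} {b = b} a≤a′ b≤b′ =
    trans (∧-distribˡ-∨-≤ e a b) (∨-monotonic a≤a′ b≤b′)

  ⇨-mono-≤[] : ∀ {e a a′ b b′} → a′ ≤[ e ] a → b ≤[ e ] b′ → a ⇨ b ≤[ e ] a′ ⇨ b′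
  ⇨-mono-≤[] {e} {a} {a′} {b} {b′} a′≤a b≤b′ = transpose-⇨ (begin
    (e ∧ (a ⇨ b)) ∧ a′  ≤⟨ ∧-greatest (trans (x∧y≤x _ _) (x∧y≤x _ _))
                             (∧-greatest (trans (x∧y≤x _ _) (x∧y≤y _ _))
                                         (trans (∧-monotonic (x∧y≤x _ _) refl) a′≤a)) ⟩
    e ∧ ((a ⇨ b) ∧ a)   ≤⟨ ∧-monotonic refl ⇨-eval ⟩
    e ∧ b               ≤⟨ b≤b′ ⟩
    b′                  ∎)

  ⟦⟧-cong-≃[] : ∀ s {e a a′ b b′} → a ≃[ e ] a′ → b ≃[ e ] b′ → ⟦_⟧ H s a b ≃[ e ] ⟦_⟧ H s a′ b′
  ⟦⟧-cong-≃[] varX a≃a′ b≃b′ = a≃a′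
  ⟦⟧-cong-≃[] varY a≃a′ b≃b′ = b≃b′
  ⟦⟧-cong-≃[] ⊤ₜ a≃a′ b≃b′ = ≃[]-refl
  ⟦⟧-cong-≃[] ⊥ₜ a≃a′ b≃b′ = ≃[]-refl
  ⟦⟧-cong-≃[] (s ∧ₜ u) a≃a′ b≃b′ with ⟦⟧-cong-≃[] s a≃a′ b≃b′ | ⟦⟧-cong-≃[] u a≃a′ b≃b′
  ... | s≤ , s≥ | u≤ , u≥ = ∧-mono-≤[] s≤ u≤ , ∧-mono-≤[] s≥ u≥
  ⟦⟧-cong-≃[] (s ∨ₜ u) a≃a′ b≃b′ with ⟦⟧-cong-≃[] s a≃a′ b≃b′ | ⟦⟧-cong-≃[] u a≃a′ b≃b′
  ... | s≤ , s≥ | u≤ , u≥ = ∨-mono-≤[] s≤ u≤ , ∨-mono-≤[] s≥ u≥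
  ⟦⟧-cong-≃[] (s ⇒ₜ u) a≃a′ b≃b′ with ⟦⟧-cong-≃[] s a≃a′ b≃b′ | ⟦⟧-cong-≃[] u a≃a′ b≃b′
  ... | s≤ , s≥ | u≤ , u≥ = ⇨-mono-≤[] s≥ u≤ , ⇨-mono-≤[] s≤ u≥

  TopOrBottom : Carrier → Set ℓ₂
  TopOrBottom a = ⊤ ≤ a ⊎ a ≤ ⊥

  ∧-TopOrBottom : ∀ {a b} → TopOrBottom a → TopOrBottom b → TopOrBottom (a ∧ b)
  ∧-TopOrBottom (inj₁ ⊤≤a) (inj₁ ⊤≤b) = inj₁ (∧-greatest ⊤≤a ⊤≤b)
  ∧-TopOrBottom (inj₂ a≤⊥) _          = inj₂ (trans (x∧y≤x _ _) a≤⊥)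
  ∧-TopOrBottom _          (inj₂ b≤⊥) = inj₂ (trans (x∧y≤y _ _) b≤⊥)

  ∨-TopOrBottom : ∀ {a b} → TopOrBottom a → TopOrBottom b → TopOrBottom (a ∨ b)
  ∨-TopOrBottom (inj₂ a≤⊥) (inj₂ b≤⊥) = inj₂ (∨-least a≤⊥ b≤⊥)
  ∨-TopOrBottom (inj₁ ⊤≤a) _          = inj₁ (trans ⊤≤a (x≤x∨y _ _))
  ∨-TopOrBottom _          (inj₁ ⊤≤b) = inj₁ (trans ⊤≤b (y≤x∨y _ _))

  ⇨-TopOrBottom : ∀ {a b} → TopOrBottom a → TopOrBottom b → TopOrBottom (a ⇨ b)
  ⇨-TopOrBottom _          (inj₁ ⊤≤b) = inj₁ (transpose-⇨ (trans (maximum _) ⊤≤b))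
  ⇨-TopOrBottom (inj₂ a≤⊥) _          =
    inj₁ (transpose-⇨ (trans (x∧y≤y _ _) (trans a≤⊥ (minimum _))))
  ⇨-TopOrBottom (inj₁ ⊤≤a) (inj₂ b≤⊥) =
    inj₂ (trans (∧-greatest refl (trans (maximum _) ⊤≤a)) (trans ⇨-eval b≤⊥))

  ⟦⟧-TopOrBottom : ∀ s {a b} → TopOrBottom a → TopOrBottom b → TopOrBottom (⟦_⟧ H s a b)
  ⟦⟧-TopOrBottom varX     a? b? = a?
  ⟦⟧-TopOrBottom varY     a? b? = b?
  ⟦⟧-TopOrBottom ⊤ₜ       a? b? = inj₁ refl
  ⟦⟧-TopOrBottom ⊥ₜ       a? b? = inj₂ refl
  ⟦⟧-TopOrBottom (s ∧ₜ u) a? b? = ∧-TopOrBottom (⟦⟧-TopOrBottom s a? b?) (⟦⟧-TopOrBottom u a? b?)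
  ⟦⟧-TopOrBottom (s ∨ₜ u) a? b? = ∨-TopOrBottom (⟦⟧-TopOrBottom s a? b?) (⟦⟧-TopOrBottom u a? b?)
  ⟦⟧-TopOrBottom (s ⇒ₜ u) a? b? = ⇨-TopOrBottom (⟦⟧-TopOrBottom s a? b?) (⟦⟧-TopOrBottom u a? b?)

  module _ {t : Term₂} (apart : IsApartnessTerm H t) where
    open IsApartnessTerm apart

    private
      _#_ : Carrier → Carrier → Carrier
      _#_ = ⟦_⟧ H t

    ⊤#-≤-neg : ∀ y → ⊤ # y ≤ neg H y
    ⊤#-≤-neg y = swap-transpose-⇨
      (trans (proj₁ (⟦⟧-cong-≃[] t ≃[]-refl (≃[self]⊤ y))) (reflexive (irrefl ⊤)))

    ⊤#-≃[neg]-⊤#⊥ : ∀ y → ⊤ # y ≃[ neg H y ] ⊤ # ⊥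
    ⊤#-≃[neg]-⊤#⊥ y = ⟦⟧-cong-≃[] t ≃[]-refl (≃[neg]⊥ y)

    apart-from-nothing⇒trivial : ∀ w → (∀ z → w # z ≤ ⊥) → TrivialTerm H t
    apart-from-nothing⇒trivial w w#≤⊥ x z = antisym
      (trans (cotrans x z w) (∨-least (trans (reflexive (sym x w)) (w#≤⊥ x)) (w#≤⊥ z)))
      (minimum _)

    ⊤#⊥≤⊥⇒⊤#≤⊥ : ⊤ # ⊥ ≤ ⊥ → ∀ z → ⊤ # z ≤ ⊥
    ⊤#⊥≤⊥⇒⊤#≤⊥ ⊤#⊥≤⊥ z = begin
      ⊤ # z              ≤⟨ ∧-greatest (⊤#-≤-neg z) refl ⟩
      neg H z ∧ (⊤ # z)  ≤⟨ proj₁ (⊤#-≃[neg]-⊤#⊥ z) ⟩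
      ⊤ # ⊥              ≤⟨ ⊤#⊥≤⊥ ⟩
      ⊥                  ∎

    ⊤≤⊤#⊥⇒neg≤⊤# : ⊤ ≤ ⊤ # ⊥ → ∀ y → neg H y ≤ ⊤ # y
    ⊤≤⊤#⊥⇒neg≤⊤# ⊤≤⊤#⊥ y = begin
      neg H y              ≤⟨ ∧-greatest refl (trans (maximum _) ⊤≤⊤#⊥) ⟩
      neg H y ∧ (⊤ # ⊥)    ≤⟨ proj₂ (⊤#-≃[neg]-⊤#⊥ y) ⟩
      ⊤ # y                ∎

mainTheorem7 : {c ℓ₁ ℓ₂ : Level} (H : HeytingAlgebra c ℓ₁ ℓ₂) (t : Term₂) →
    NonTrivialHA H → IsApartnessTerm H t → NonTrivialTerm H t →
    ∀ y → HeytingAlgebra._≈_ H (⟦_⟧ H t (HeytingAlgebra.⊤ H) y) (neg H y)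
mainTheorem7 H t _ apart nonTrivial y
  with ⟦⟧-TopOrBottom H t (inj₁ (HeytingAlgebra.refl H)) (inj₂ (HeytingAlgebra.refl H))
... | inj₁ ⊤≤⊤#⊥ = HeytingAlgebra.antisym H (⊤#-≤-neg H apart y) (⊤≤⊤#⊥⇒neg≤⊤# H apart ⊤≤⊤#⊥ y)
... | inj₂ ⊤#⊥≤⊥ =
  contradiction (apart-from-nothing⇒trivial H apart _ (⊤#⊥≤⊥⇒⊤#≤⊥ H apart ⊤#⊥≤⊥)) nonTrivial
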